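{- Let $\ell\ge 1$ and define recursively $(a_0,b_0)=(\ell+1,2\ell+2)$ and, for all $n\ge 1$, \[ a_n=\mathrm{mex}(\{a_i,b_i: i<n\}\cup\{0,1,\dots,\ell\}),\qquad b_n=a_n+n+\ell+1 . \] Then the set of non-terminal $\mathcal{P}$-positions of $K^\ell$ is $\{(a_n,b_n): n\ge 0\}\cup\{(b_n,a_n): n\ge 0\}$.
   Context: $\mathrm{mex}\,S=\min(\mathbb{N}\setminus S)$. Positions are pairs $(x,y)\in\mathbb{N}^2$. A Wythoff move from $(x,y)$ leads to $(x-i,y)$ with $1\le i\le x$, to $(x,y-i)$ with $1\le i\le y$, or to $(x-i,y-i)$ with $1\le i\le\min(x,y)$. For $\ell\in\mathbb{N}$, $K^\ell$ is the two-player impartial game with Wythoff moves in which the positions of $\{(x,y): x+y\le\ell\}$ are terminal: no move is allowed from a terminal position, and a player who moves into a terminal position wins (normal play). A $\mathcal{P}$-position is a position from which the previous player has a winning strategy. -}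

module Defs where

open import Data.Nat using (ℕ; zero; suc; _+_; _∸_; _≤_; _<_; _≟_)
open import Data.Product using (_×_; _,_; proj₁; proj₂)
open import Data.List using (List; []; _∷_; _++_; _∷ʳ_; length; upTo; concatMap)
open import Data.List.Membership.DecPropositional (_≟_) using (_∈?_)
open import Relation.Nullary using (yes; no)

Pos : Set
Pos = ℕ × ℕ

Terminal : ℕ → Pos → Set
Terminal ℓ (x , y) = x + y ≤ ℓ

data WMove : Pos → Pos → Set where
  left  : ∀ {x y} i → 1 ≤ i → i ≤ x → WMove (x , y) (x ∸ i , y)
  down  : ∀ {x y} i → 1 ≤ i → i ≤ y → WMove (x , y) (x , y ∸ i)
  diag  : ∀ {x y} i → 1 ≤ i → i ≤ x → i ≤ y → WMove (x , y) (x ∸ i , y ∸ i)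

data Move (ℓ : ℕ) (p q : Pos) : Set where
  move : ℓ < proj₁ p + proj₂ p → WMove p q → Move ℓ p q

-- Outcome classes of K^ℓ under normal play (inductively: the game is
-- finite, so "previous player has a winning strategy" is the least
-- solution of these clauses).
mutual
  data IsP (ℓ : ℕ) (p : Pos) : Set where
    isP : (∀ q → Move ℓ p q → IsN ℓ q) → IsP ℓ p

  data IsN (ℓ : ℕ) (p : Pos) : Set where
    isN : ∀ q → Move ℓ p q → IsP ℓ q → IsN ℓ p

-- mex of a finite list: least natural number not in the list.
-- Search from k with fuel; the answer is always ≤ length of the list.
mexFrom : ℕ → ℕ → List ℕ → ℕ
mexFrom zero    k L = k
mexFrom (suc f) k L with k ∈? L
... | yes _ = mexFrom f (suc k) L
... | no  _ = k

mex : List ℕ → ℕ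
mex L = mexFrom (length L) 0 L

-- The sequence (a_n, b_n) for K^ℓ.
-- step ℓ n h computes (a_n , b_n) from the history h = [(a_0,b_0),…,(a_{n-1},b_{n-1})].
step : ℕ → ℕ → List (ℕ × ℕ) → ℕ × ℕ
step ℓ zero    h = (suc ℓ , 2 + ℓ + ℓ)
step ℓ (suc n) h =
  let a = mex (concatMap (λ p → proj₁ p ∷ proj₂ p ∷ []) h ++ upTo (suc ℓ))
  in (a , a + suc n + ℓ + 1)

history : ℕ → ℕ → List (ℕ × ℕ)
history ℓ zero    = []
history ℓ (suc n) = history ℓ n ∷ʳ step ℓ n (history ℓ n)

pair : ℕ → ℕ → ℕ × ℕ
pair ℓ n = step ℓ n (history ℓ n)

a : ℕ → ℕ → ℕ
a ℓ n = proj₁ (pair ℓ n)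

b : ℕ → ℕ → ℕ
b ℓ n = proj₂ (pair ℓ n)

{-# OPTIONS --safe #-}
module Submission where

-- The P-positions of K^ℓ form the kernel of its (well-founded) move graph:
-- the unique set K, containing the terminal positions, such that no move
-- joins two positions of K and every position outside K has a move into
-- K.  So it suffices to check these two properties for the terminal
-- positions together with S = {(a_n , b_n), (b_n , a_n)}.
--
-- By the mex construction a and b are strictly increasing and together
-- enumerate every number > ℓ exactly once, while the gaps b_n − a_n =
-- n + ℓ + 1 enumerate every number > ℓ exactly once as well.  A Wythoff
-- move keeps one coordinate or the difference of the coordinates, so it
-- cannot join two positions of S.  Conversely, a sorted non-terminal
-- position outside S either lowers its larger coordinate onto a terminal
-- position or onto a position of S, or it is (a_n , a_n + d) with
-- d < b_n − a_n: then a diagonal move reaches (0 , d), terminal if d ≤ ℓ,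
-- and otherwise reaches (a_m , b_m) for the m with b_m − a_m = d.

open import Defs
open import Data.Nat using (ℕ; zero; suc; _+_; _∸_; _≤_; _<_; _≟_; z≤n; s≤s)
open import Data.Nat.Properties
open import Algebra.Properties.CommutativeSemigroup +-commutativeSemigroup using (xy∙z≈xz∙y)
open import Data.Fin using (Fin; toℕ)
open import Data.Fin.Properties using (injective⇒≤; toℕ-injective; toℕ≤pred[n])
open import Data.List using (List; []; _∷_; _++_; length; lookup; concatMap; upTo)
open import Data.List.Properties using (concatMap-++)
open import Data.List.Membership.DecPropositional (_≟_) using (_∈?_; _∈_; _∉_)
open import Data.List.Membership.Propositional.Properties
  using (∈-++⁺ˡ; ∈-++⁺ʳ; ∈-++⁻; ∈-upTo⁺; ∈-upTo⁻)
open import Data.List.Relation.Unary.Any as Any using (here; there)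
open import Data.List.Relation.Unary.Any.Properties using (lookup-index)
open import Data.Nat.Induction using (<-wellFounded)
open import Data.Product using (_×_; _,_; proj₁; proj₂; ∃-syntax; swap)
open import Data.Product.Properties using (,-injective)
open import Data.Sum using (_⊎_; inj₁; inj₂; [_,_]′; map; map₂)
open import Function using (_∘_; _on_)
open import Function.Bundles using (_⇔_; mk⇔)
open import Function.Definitions using (Injective)
open import Induction.WellFounded using (Acc; acc)
open import Relation.Binary.Construct.On as On using ()
open import Relation.Binary.Definitions using (Monotonic₁; tri<; tri≈; tri>)
open import Relation.Binary.PropositionalEquality hiding ([_])
open import Relation.Nullary using (¬_; yes; no; contradiction)

range⊆⇒<length : ∀ {n} (L : List ℕ) → (∀ {j} → j ≤ n → j ∈ L) → n < length L
range⊆⇒<length {n} L range⊆L = injective⇒≤ position-injective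
  where
  position : Fin (suc n) → Fin (length L)
  position i = Any.index (range⊆L (toℕ≤pred[n] i))

  position-injective : Injective _≡_ _≡_ position
  position-injective {i} {j} same = toℕ-injective (begin
    toℕ i                  ≡⟨ lookup-index (range⊆L (toℕ≤pred[n] i)) ⟩
    lookup L (position i)  ≡⟨ cong (lookup L) same ⟩
    lookup L (position j)  ≡⟨ lookup-index (range⊆L (toℕ≤pred[n] j)) ⟨
    toℕ j                  ∎)
    where open ≡-Reasoning

mexFrom-minimal : ∀ f k L {j} → k ≤ j → j < mexFrom f k L → j ∈ L
mexFrom-minimal zero    k L k≤j j<k = contradiction k≤j (<⇒≱ j<k)
mexFrom-minimal (suc f) k L {j} k≤j j<mex with k ∈? L
... | no _   = contradiction k≤j (<⇒≱ j<mex)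
... | yes k∈L with m≤n⇒m<n∨m≡n k≤j
...   | inj₁ k<j  = mexFrom-minimal f (suc k) L k<j j<mex
...   | inj₂ refl = k∈L

mexFrom-exit : ∀ f k L → mexFrom f k L ∉ L ⊎ mexFrom f k L ≡ k + f
mexFrom-exit zero    k L = inj₂ (sym (+-identityʳ k))
mexFrom-exit (suc f) k L with k ∈? L
... | no k∉L = inj₁ k∉L
... | yes _  = map₂ (λ eq → trans eq (sym (+-suc k f))) (mexFrom-exit f (suc k) L)

mex-minimal : ∀ L {j} → j < mex L → j ∈ L
mex-minimal L = mexFrom-minimal (length L) 0 L z≤n

-- If the search runs out of fuel, 0, …, length L − 1 all lie in L, so
-- L has no room left for length L.
mex-∉ : ∀ L → mex L ∉ L
mex-∉ L mex∈L with mexFrom-exit (length L) 0 L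
... | inj₁ mex∉L    = mex∉L mex∈L
... | inj₂ mex≡len = <-irrefl refl (range⊆⇒<length L range⊆L)
  where
  range⊆L : ∀ {j} → j ≤ length L → j ∈ L
  range⊆L j≤len with m≤n⇒m<n∨m≡n j≤len
  ... | inj₁ j<len = mex-minimal L (subst (_ <_) (sym mex≡len) j<len)
  ... | inj₂ refl  = subst (_∈ L) mex≡len mex∈L

strictMono-by-steps : ∀ {f : ℕ → ℕ} → (∀ n → f n < f (suc n)) → Monotonic₁ _<_ _<_ f
strictMono-by-steps {f} f<f∘suc {m} {suc n} m<1+n with m<1+n⇒m<n∨m≡n m<1+n
... | inj₁ m<n  = <-trans (strictMono-by-steps f<f∘suc m<n) (f<f∘suc n)
... | inj₂ refl = f<f∘suc n

strictMono⇒injective : ∀ {f : ℕ → ℕ} → Monotonic₁ _<_ _<_ f → Injective _≡_ _≡_ f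
strictMono⇒injective {f} f-mono {m} {n} fm≡fn with <-cmp m n
... | tri< m<n _ _ = contradiction fm≡fn (<⇒≢ (f-mono m<n))
... | tri≈ _ m≡n _ = m≡n
... | tri> _ _ n<m = contradiction (sym fm≡fn) (<⇒≢ (f-mono n<m))

strictMono⇒≤ : ∀ {f : ℕ → ℕ} → Monotonic₁ _<_ _<_ f → ∀ n → n ≤ f n
strictMono⇒≤ f-mono zero    = z≤n
strictMono⇒≤ f-mono (suc n) = ≤-<-trans (strictMono⇒≤ f-mono n) (f-mono (n<1+n n))

size : Pos → ℕ
size p = proj₁ p + proj₂ p

-- Wythoff moves in additive form, free of truncated subtraction.
data Step : Pos → Pos → Set where
  shrinkˡ     : ∀ {x y u} → u < x → Step (x , y) (u , y)
  shrinkʳ     : ∀ {x y v} → v < y → Step (x , y) (x , v)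
  shrink-both : ∀ {x y u v} i → 0 < i → x ≡ u + i → y ≡ v + i → Step (x , y) (u , v)

WMove⇒Step : ∀ {p q} → WMove p q → Step p q
WMove⇒Step (left i 0<i i≤x)     = shrinkˡ (∸-monoʳ-< 0<i i≤x)
WMove⇒Step (down i 0<i i≤y)     = shrinkʳ (∸-monoʳ-< 0<i i≤y)
WMove⇒Step (diag i 0<i i≤x i≤y) = shrink-both i 0<i (sym (m∸n+n≡m i≤x)) (sym (m∸n+n≡m i≤y))

Step⇒WMove : ∀ {p q} → Step p q → WMove p q
Step⇒WMove {x , y} (shrinkˡ {u = u} u<x) =
  subst (λ z → WMove (x , y) (z , y)) (m∸[m∸n]≡n (<⇒≤ u<x))
    (left (x ∸ u) (m<n⇒0<n∸m u<x) (m∸n≤m x u))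
Step⇒WMove {x , y} (shrinkʳ {v = v} v<y) =
  subst (λ z → WMove (x , y) (x , z)) (m∸[m∸n]≡n (<⇒≤ v<y))
    (down (y ∸ v) (m<n⇒0<n∸m v<y) (m∸n≤m y v))
Step⇒WMove (shrink-both {u = u} {v} i 0<i refl refl) =
  subst (WMove (u + i , v + i)) (cong₂ _,_ (m+n∸n≡m u i) (m+n∸n≡m v i))
    (diag i 0<i (m≤n+m i u) (m≤n+m i v))

Step-swap : ∀ {p q} → Step p q → Step (swap p) (swap q)
Step-swap (shrinkˡ u<x)                  = shrinkʳ u<x
Step-swap (shrinkʳ v<y)                  = shrinkˡ v<y
Step-swap (shrink-both i 0<i x≡u+i y≡v+i) = shrink-both i 0<i y≡v+i x≡u+i

Step-decreasing : ∀ {p q} → Step p q → size q < size p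
Step-decreasing {x , y} (shrinkˡ u<x) = +-monoˡ-< y u<x
Step-decreasing {x , y} (shrinkʳ v<y) = +-monoʳ-< x v<y
Step-decreasing (shrink-both {u = u} {v} i 0<i refl refl) = +-mono-< (m<m+n u 0<i) (m<m+n v 0<i)

IsP⇒¬IsN : ∀ {ℓ p} → IsP ℓ p → ¬ IsN ℓ p
IsP⇒¬IsN (isP P→N) (isN q p→q q-IsP) = IsP⇒¬IsN q-IsP (P→N q p→q)

module Kernel (ℓ : ℕ) (S : Pos → Set) where

  Target : Pos → Set
  Target p = Terminal ℓ p ⊎ S p

  Independent : Set
  Independent = ∀ {p q} → S p → Step p q → ¬ Target q

  MovesToTarget : Pos → Set
  MovesToTarget p = ∃[ q ] (Step p q × Target q)

  Absorbing : Set
  Absorbing = ∀ p → ℓ < size p → S p ⊎ MovesToTarget p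

  module _ (independent : Independent) (absorbing : Absorbing) where

    target⇒IsP : ∀ p → Target p → IsP ℓ p
    target⇒IsP p = go p (On.wellFounded size <-wellFounded p)
      where
      go : ∀ p → Acc (_<_ on size) p → Target p → IsP ℓ p
      go p _ (inj₁ terminal) =
        isP λ { q (move nonterminal _) → contradiction terminal (<⇒≱ nonterminal) }
      go p (acc smaller) (inj₂ p∈S) = isP λ { q (move _ p→q) → escape q (WMove⇒Step p→q) }
        where
        escape : ∀ q → Step p q → IsN ℓ q
        escape q p→q with nonterminal ← ≰⇒> (independent p∈S p→q ∘ inj₁)
                         | absorbing q nonterminal
        ... | inj₁ q∈S = contradiction (inj₂ q∈S) (independent p∈S p→q)
        ... | inj₂ (r , q→r , r-target) =
          isN r (move nonterminal (Step⇒WMove q→r))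
            (go r (smaller (<-trans (Step-decreasing q→r) (Step-decreasing p→q))) r-target)

    IsP⇒S : ∀ p → ℓ < size p → IsP ℓ p → S p
    IsP⇒S p nonterminal p-IsP with absorbing p nonterminal
    ... | inj₁ p∈S = p∈S
    ... | inj₂ (q , p→q , q-target) =
      contradiction (isN q (move nonterminal (Step⇒WMove p→q)) (target⇒IsP q q-target))
                    (IsP⇒¬IsN p-IsP)

    P-positions : (∀ {p} → S p → ℓ < size p) → ∀ p → (ℓ < size p × IsP ℓ p) ⇔ S p
    P-positions S⇒nonterminal p = mk⇔
      (λ (nonterminal , p-IsP) → IsP⇒S p nonterminal p-IsP)
      (λ p∈S → S⇒nonterminal p∈S , target⇒IsP p (inj₂ p∈S))

module _ (ℓ : ℕ) where

  gap : ℕ → ℕ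
  gap n = n + suc ℓ

  ℓ<gap : ∀ n → ℓ < gap n
  ℓ<gap n = m≤n+m (suc ℓ) n

  values : List (ℕ × ℕ) → List ℕ
  values = concatMap (λ p → proj₁ p ∷ proj₂ p ∷ [])

  -- a ℓ (suc n) is, by definition, mex (excluded (suc n)).
  excluded : ℕ → List ℕ
  excluded n = values (history ℓ n) ++ upTo (suc ℓ)

  Earlier : ℕ → ℕ → Set
  Earlier n v = ∃[ i ] (i < n × (v ≡ a ℓ i ⊎ v ≡ b ℓ i))

  ∈-values-history⁻ : ∀ n {v} → v ∈ values (history ℓ n) → Earlier n v
  ∈-values-history⁻ (suc n) v∈
    with ∈-++⁻ (values (history ℓ n)) (subst (_ ∈_) (concatMap-++ _ (history ℓ n) _) v∈)
  ... | inj₁ v∈old = let i , i<n , v≡ = ∈-values-history⁻ n v∈old in i , m<n⇒m<1+n i<n , v≡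
  ... | inj₂ (here v≡a)         = n , n<1+n n , inj₁ v≡a
  ... | inj₂ (there (here v≡b)) = n , n<1+n n , inj₂ v≡b

  ∈-values-history⁺ : ∀ n {v} → Earlier n v → v ∈ values (history ℓ n)
  ∈-values-history⁺ (suc n) (i , i<1+n , v≡) =
    subst (_ ∈_) (sym (concatMap-++ _ (history ℓ n) _)) v∈
    where
    v∈ : _ ∈ values (history ℓ n) ++ a ℓ n ∷ b ℓ n ∷ []
    v∈ with m<1+n⇒m<n∨m≡n i<1+n
    ... | inj₁ i<n  = ∈-++⁺ˡ (∈-values-history⁺ n (i , i<n , v≡))
    ... | inj₂ refl = ∈-++⁺ʳ (values (history ℓ n)) ([ here , there ∘ here ]′ v≡)

  a-fresh : ∀ n → ¬ Earlier n (a ℓ n)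
  a-fresh (suc n) earlier = mex-∉ (excluded (suc n)) (∈-++⁺ˡ (∈-values-history⁺ (suc n) earlier))

  a-least : ∀ n {k} → k < a ℓ n → k ≤ ℓ ⊎ Earlier n k
  a-least zero    k<a = inj₁ (≤-pred k<a)
  a-least (suc n) k<a with ∈-++⁻ (values (history ℓ (suc n))) (mex-minimal (excluded (suc n)) k<a)
  ... | inj₁ k∈values = inj₂ (∈-values-history⁻ (suc n) k∈values)
  ... | inj₂ k∈range  = inj₁ (≤-pred (∈-upTo⁻ k∈range))

  ℓ<a : ∀ n → ℓ < a ℓ n
  ℓ<a zero    = ≤-refl
  ℓ<a (suc n) = ≰⇒> λ a≤ℓ →
    mex-∉ (excluded (suc n)) (∈-++⁺ʳ (values (history ℓ (suc n))) (∈-upTo⁺ (s≤s a≤ℓ)))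

  a-strictMono : Monotonic₁ _<_ _<_ (a ℓ)
  a-strictMono = strictMono-by-steps λ n → ≰⇒> λ a₊≤a → a-fresh (suc n) (earlier n a₊≤a)
    where
    earlier : ∀ n → a ℓ (suc n) ≤ a ℓ n → Earlier (suc n) (a ℓ (suc n))
    earlier n a₊≤a with m≤n⇒m<n∨m≡n a₊≤a
    ... | inj₂ a₊≡a = n , n<1+n n , inj₁ a₊≡a
    ... | inj₁ a₊<a with a-least n a₊<a
    ...   | inj₁ a₊≤ℓ              = contradiction a₊≤ℓ (<⇒≱ (ℓ<a (suc n)))
    ...   | inj₂ (i , i<n , a₊≡) = i , m<n⇒m<1+n i<n , a₊≡

  b≡a+gap : ∀ n → b ℓ n ≡ a ℓ n + gap n
  b≡a+gap zero    = cong suc (sym (+-suc ℓ ℓ))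
  b≡a+gap (suc n) = begin
    a₊ + suc n + ℓ + 1       ≡⟨ +-assoc (a₊ + suc n) ℓ 1 ⟩
    a₊ + suc n + (ℓ + 1)     ≡⟨ cong (a₊ + suc n +_) (+-comm ℓ 1) ⟩
    a₊ + suc n + suc ℓ       ≡⟨ +-assoc a₊ (suc n) (suc ℓ) ⟩
    a₊ + gap (suc n)         ∎
    where
    open ≡-Reasoning
    a₊ : ℕ
    a₊ = a ℓ (suc n)

  a<b : ∀ n → a ℓ n < b ℓ n
  a<b n = subst (a ℓ n <_) (sym (b≡a+gap n)) (m<m+n (a ℓ n) (≤-<-trans z≤n (ℓ<gap n)))

  b-strictMono : Monotonic₁ _<_ _<_ (b ℓ)
  b-strictMono {m} {n} m<n = subst₂ _<_ (sym (b≡a+gap m)) (sym (b≡a+gap n))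
    (+-mono-< (a-strictMono m<n) (+-monoˡ-< (suc ℓ) m<n))

  a≢b : ∀ m n → a ℓ m ≢ b ℓ n
  a≢b m n am≡bn with <-cmp m n
  ... | tri< m<n _ _  = <-irrefl am≡bn (<-trans (a-strictMono m<n) (a<b n))
  ... | tri≈ _ refl _ = <-irrefl am≡bn (a<b n)
  ... | tri> _ _ n<m  = a-fresh m (n , n<m , inj₂ am≡bn)

  >ℓ⇒a-or-b : ∀ {k} → ℓ < k → ∃[ n ] (k ≡ a ℓ n ⊎ k ≡ b ℓ n)
  >ℓ⇒a-or-b {k} ℓ<k with a-least (suc k) (strictMono⇒≤ a-strictMono (suc k))
  ... | inj₁ k≤ℓ            = contradiction k≤ℓ (<⇒≱ ℓ<k)
  ... | inj₂ (n , _ , k≡) = n , k≡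

  a-injective : Injective _≡_ _≡_ (a ℓ)
  a-injective = strictMono⇒injective a-strictMono

  b-injective : Injective _≡_ _≡_ (b ℓ)
  b-injective = strictMono⇒injective b-strictMono

  gap-injective : Injective _≡_ _≡_ gap
  gap-injective = strictMono⇒injective (+-monoˡ-< (suc ℓ))

  gap-surjective : ∀ {d} → ℓ < d → ∃[ m ] gap m ≡ d
  gap-surjective ℓ<d = _ , m∸n+n≡m ℓ<d

  Sequence : Pos → Set
  Sequence p = ∃[ n ] (p ≡ (a ℓ n , b ℓ n) ⊎ p ≡ (b ℓ n , a ℓ n))

  Sequence-swap : ∀ {p} → Sequence p → Sequence (swap p)
  Sequence-swap (n , inj₁ refl) = n , inj₂ refl
  Sequence-swap (n , inj₂ refl) = n , inj₁ refl

  Sequence⇒nonterminal : ∀ {p} → Sequence p → ℓ < size p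
  Sequence⇒nonterminal (n , inj₁ refl) = <-≤-trans (ℓ<a n) (m≤m+n (a ℓ n) (b ℓ n))
  Sequence⇒nonterminal (n , inj₂ refl) = <-≤-trans (ℓ<a n) (m≤n+m (a ℓ n) (b ℓ n))

  Sequence-with-a : ∀ n {v} → Sequence (a ℓ n , v) → v ≡ b ℓ n
  Sequence-with-a n (m , inj₁ eq) with an≡am , refl ← ,-injective eq =
    cong (b ℓ) (sym (a-injective {n} {m} an≡am))
  Sequence-with-a n (m , inj₂ eq) = contradiction (proj₁ (,-injective eq)) (a≢b n m)

  Sequence-with-b : ∀ n {u} → Sequence (u , b ℓ n) → u ≡ a ℓ n
  Sequence-with-b n (m , inj₁ eq) with refl , bn≡bm ← ,-injective eq =
    cong (a ℓ) (sym (b-injective {n} {m} bn≡bm))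
  Sequence-with-b n (m , inj₂ eq) = contradiction (sym (proj₂ (,-injective eq))) (a≢b m n)

  Sequence-with-gap : ∀ n {u} → Sequence (u , u + gap n) → u ≡ a ℓ n
  Sequence-with-gap n (m , inj₁ eq) with refl , am+gn≡bm ← ,-injective eq =
    cong (a ℓ) (sym (gap-injective (+-cancelˡ-≡ (a ℓ m) (gap n) (gap m)
                                     (trans am+gn≡bm (b≡a+gap m)))))
  Sequence-with-gap n (m , inj₂ eq) with refl , bm+gn≡am ← ,-injective eq =
    contradiction (≤-trans (m≤m+n (b ℓ m) (gap n)) (≤-reflexive bm+gn≡am)) (<⇒≱ (a<b m))

  diagonal-keeps-gap : ∀ n {u v} i → a ℓ n ≡ u + i → b ℓ n ≡ v + i → v ≡ u + gap n
  diagonal-keeps-gap n {u} {v} i an≡u+i bn≡v+i = +-cancelʳ-≡ i v (u + gap n) (begin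
    v + i          ≡⟨ bn≡v+i ⟨
    b ℓ n          ≡⟨ b≡a+gap n ⟩
    a ℓ n + gap n  ≡⟨ cong (_+ gap n) an≡u+i ⟩
    u + i + gap n  ≡⟨ xy∙z≈xz∙y u i (gap n) ⟩
    u + gap n + i  ∎)
    where open ≡-Reasoning

  open Kernel ℓ Sequence using (Target; Independent; MovesToTarget; Absorbing)

  Target-swap : ∀ {p} → Target p → Target (swap p)
  Target-swap {x , y} (inj₁ terminal) = inj₁ (subst (_≤ ℓ) (+-comm x y) terminal)
  Target-swap (inj₂ p∈S) = inj₂ (Sequence-swap p∈S)

  lower-step-¬target : ∀ n {q} → Step (a ℓ n , b ℓ n) q → ¬ Target q
  lower-step-¬target n (shrinkˡ {u = u} u<a) = [
      <⇒≱ (<-≤-trans (<-trans (ℓ<a n) (a<b n)) (m≤n+m (b ℓ n) u)) ,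
      (λ s → <-irrefl (Sequence-with-b n s) u<a) ]′
  lower-step-¬target n (shrinkʳ {v = v} v<b) = [
      <⇒≱ (<-≤-trans (ℓ<a n) (m≤m+n (a ℓ n) v)) ,
      (λ s → <-irrefl (Sequence-with-a n s) v<b) ]′
  lower-step-¬target n (shrink-both {u = u} i 0<i an≡u+i bn≡v+i)
    with refl ← diagonal-keeps-gap n i an≡u+i bn≡v+i = [
      <⇒≱ (<-≤-trans (ℓ<gap n) (≤-trans (m≤n+m (gap n) u) (m≤n+m (u + gap n) u))) ,
      (λ s → <-irrefl (trans (Sequence-with-gap n s) an≡u+i) (m<m+n u 0<i)) ]′

  independent : Independent
  independent (n , inj₁ refl) = lower-step-¬target n
  independent (n , inj₂ refl) step = lower-step-¬target n (Step-swap step) ∘ Target-swap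

  diagonal-to-lower : ∀ {m n} → m < n → Step (a ℓ n , a ℓ n + gap m) (a ℓ m , b ℓ m)
  diagonal-to-lower {m} {n} m<n = shrink-both i (m<n⇒0<n∸m am<an) (sym am+i≡an) (begin
    a ℓ n + gap m      ≡⟨ cong (_+ gap m) am+i≡an ⟨
    a ℓ m + i + gap m  ≡⟨ xy∙z≈xz∙y (a ℓ m) i (gap m) ⟩
    a ℓ m + gap m + i  ≡⟨ cong (_+ i) (b≡a+gap m) ⟨
    b ℓ m + i          ∎)
    where
    open ≡-Reasoning
    am<an : a ℓ m < a ℓ n
    am<an = a-strictMono m<n
    i : ℕ
    i = a ℓ n ∸ a ℓ m
    am+i≡an : a ℓ m + i ≡ a ℓ n
    am+i≡an = m+[n∸m]≡n (<⇒≤ am<an)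

  absorbing-from-a : ∀ n d → Sequence (a ℓ n , a ℓ n + d) ⊎ MovesToTarget (a ℓ n , a ℓ n + d)
  absorbing-from-a n d with <-cmp d (gap n)
  ... | tri≈ _ refl _ = inj₁ (n , inj₁ (cong (a ℓ n ,_) (sym (b≡a+gap n))))
  ... | tri> _ _ gap<d = inj₂ ((a ℓ n , b ℓ n) ,
          shrinkʳ (subst (_< a ℓ n + d) (sym (b≡a+gap n)) (+-monoʳ-< (a ℓ n) gap<d)) ,
          inj₂ (n , inj₁ refl))
  ... | tri< d<gap _ _ with d ≤? ℓ
  ...   | yes d≤ℓ = inj₂ ((0 , d) ,
              shrink-both (a ℓ n) (≤-<-trans z≤n (ℓ<a n)) refl (+-comm (a ℓ n) d) ,
              inj₁ d≤ℓ)
  ...   | no d≰ℓ with gap-surjective (≰⇒> d≰ℓ)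
  ...     | m , refl = inj₂ ((a ℓ m , b ℓ m) ,
              diagonal-to-lower (+-cancelʳ-< (suc ℓ) m n d<gap) ,
              inj₂ (m , inj₁ refl))

  absorbing-sorted : ∀ x d → ℓ < x + (x + d) → Sequence (x , x + d) ⊎ MovesToTarget (x , x + d)
  absorbing-sorted x d nonterminal with x ≤? ℓ
  ... | yes x≤ℓ = inj₂ ((x , ℓ ∸ x) ,
          shrinkʳ (+-cancelˡ-< x (ℓ ∸ x) (x + d)
                    (subst (_< x + (x + d)) (sym x+[ℓ∸x]≡ℓ) nonterminal)) ,
          inj₁ (≤-reflexive x+[ℓ∸x]≡ℓ))
    where
    x+[ℓ∸x]≡ℓ : x + (ℓ ∸ x) ≡ ℓ
    x+[ℓ∸x]≡ℓ = m+[n∸m]≡n x≤ℓ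
  ... | no x≰ℓ with >ℓ⇒a-or-b (≰⇒> x≰ℓ)
  ...   | n , inj₁ refl = absorbing-from-a n d
  ...   | n , inj₂ refl = inj₂ ((b ℓ n , a ℓ n) ,
              shrinkʳ (<-≤-trans (a<b n) (m≤m+n (b ℓ n) d)) ,
              inj₂ (n , inj₂ refl))

  absorbing : Absorbing
  absorbing (x , y) nonterminal with ≤-total x y
  ... | inj₁ x≤y with d , refl ← m≤n⇒∃[o]m+o≡n x≤y = absorbing-sorted x d nonterminal
  ... | inj₂ y≤x with d , refl ← m≤n⇒∃[o]m+o≡n y≤x =
    map Sequence-swap (λ (q , step , q-target) → swap q , Step-swap step , Target-swap q-target)
      (absorbing-sorted y d (subst (ℓ <_) (+-comm x y) nonterminal))

theorem17 : (ℓ : ℕ) → 1 ≤ ℓ → (x y : ℕ) →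
    ((ℓ < x + y × IsP ℓ (x , y))
      ⇔ (∃[ n ] ((x , y) ≡ (a ℓ n , b ℓ n) ⊎ (x , y) ≡ (b ℓ n , a ℓ n))))
theorem17 ℓ _ x y =
  Kernel.P-positions ℓ (Sequence ℓ) (independent ℓ) (absorbing ℓ) (Sequence⇒nonterminal ℓ) (x , y)
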